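{- Let $r$ and $m$ be positive integers and let $G$ be the complete $m$-partite graph $K_{r,\ldots,r}$ (each of the $m$ parts having $r$ vertices). Then the direct product $G \times G$ is well-covered.
   Context: Graphs are finite and simple. The direct product $G\times H$ has vertex set $V(G)\times V(H)$, with $(g_1,h_1)(g_2,h_2)$ an edge iff $g_1g_2\in E(G)$ and $h_1h_2\in E(H)$. A graph is well-covered if all of its maximal independent sets have the same cardinality. -}

module Defs where

open import Data.Nat using (ℕ; _*_)
open import Data.Fin using (Fin; remQuot)
open import Data.Fin.Subset using (Subset; _∈_; _⊆_; ∣_∣)
open import Data.Product using (_×_; proj₁; proj₂)
open import Relation.Binary.PropositionalEquality using (_≡_)
open import Relation.Nullary using (¬_)

record Graph : Set₁ where
  field
    n     : ℕ
    Adj   : Fin n → Fin n → Set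
    irrefl : ∀ {u} → ¬ Adj u u
    sym   : ∀ {u v} → Adj u v → Adj v u
open Graph public

Independent : (G : Graph) → Subset (n G) → Set
Independent G S = ∀ u v → u ∈ S → v ∈ S → ¬ Adj G u v

MaximalIndependent : (G : Graph) → Subset (n G) → Set
MaximalIndependent G S =
  Independent G S × (∀ T → Independent G T → S ⊆ T → T ⊆ S)

WellCovered : Graph → Set
WellCovered G = ∀ S T → MaximalIndependent G S → MaximalIndependent G T → ∣ S ∣ ≡ ∣ T ∣

-- Direct (tensor/categorical) product. Vertex set Fin (n G * n H) ≅ Fin (n G) × Fin (n H)
-- via remQuot; (g₁,h₁)(g₂,h₂) is an edge iff g₁g₂ ∈ E(G) and h₁h₂ ∈ E(H).
fstᵖ : ∀ {a b} → Fin (a * b) → Fin a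
fstᵖ {a} {b} x = proj₁ (remQuot {a} b x)

sndᵖ : ∀ {a b} → Fin (a * b) → Fin b
sndᵖ {a} {b} x = proj₂ (remQuot {a} b x)

_×ᵍ_ : Graph → Graph → Graph
G ×ᵍ H = record
  { n = n G * n H
  ; Adj = λ x y → Adj G (fstᵖ {n G} {n H} x) (fstᵖ {n G} {n H} y)
                × Adj H (sndᵖ {n G} {n H} x) (sndᵖ {n G} {n H} y)
  ; irrefl = λ p → irrefl G (proj₁ p)
  ; sym = λ p → sym G (proj₁ p) , sym H (proj₂ p)
  }
  where open import Data.Product using (_,_)

-- Complete m-partite graph K_{r,…,r}: vertex set Fin (m * r); vertex v lies in
-- part fstᵖ v : Fin m (each part has r vertices); two vertices are
-- adjacent iff they lie in different parts.
completeMultipartite : (m r : ℕ) → Graph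
completeMultipartite m r = record
  { n = m * r
  ; Adj = λ u v → ¬ (fstᵖ {m} {r} u ≡ fstᵖ {m} {r} v)
  ; irrefl = λ p → p Relation.Binary.PropositionalEquality.refl
  ; sym = λ p q → p (Relation.Binary.PropositionalEquality.sym q)
  }

-- In G × G with G = K_{r,…,r}, two vertices are non-adjacent exactly when their
-- first coordinates lie in a common part or their second coordinates do. Hence
-- in an independent set any two vertices agree on the first part or on the
-- second part, and this forces the whole set into a "row" (first coordinate in
-- a fixed part) or a "column" (second coordinate in a fixed part). Rows and
-- columns are independent, so the maximal independent sets are exactly the
-- rows and columns, and each of them has r · mr vertices.
module Submission where

open import Defs
open import Data.Nat using (ℕ; NonZero; zero; suc; _+_; _*_; >-nonZero⁻¹)
open import Data.Nat.Properties using (*-comm; *-identityˡ)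
open import Data.Fin using (Fin; zero; suc; remQuot; _↑ˡ_; _↑ʳ_; fromℕ<)
open import Data.Fin.Properties using (remQuot-combine; splitAt-↑ʳ; any?; _≟_)
open import Data.Fin.Subset using (Subset; _∈_; _⊆_; ∣_∣; inside; outside; ⁅_⁆)
open import Data.Fin.Subset.Properties
  using (_∈?_; ⊆-antisym; ∣⊤∣≡n; ∣⊥∣≡0; ∣⁅x⁆∣≡1; x∈⁅x⁆; x∈⁅y⁆⇒x≡y)
open import Data.Vec using ([]; _∷_; _++_; tabulate; lookup; replicate; allFin)
open import Data.Vec.Properties using (tabulate-∘; map-const; lookup∘tabulate; tabulate∘lookup; tabulate-cong; []=⇒lookup; lookup⇒[]=)
open import Data.Product using (_×_; _,_; proj₁; proj₂; ∃; map₁)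
open import Data.Sum using (_⊎_; inj₁; inj₂; [_,_]′)
open import Function using (_∘_; id)
open import Relation.Nullary using (yes; no; ¬?; contradiction)
open import Relation.Nullary.Decidable using (_×-dec_; decidable-stable)
open import Relation.Binary.PropositionalEquality
  using (_≡_; refl; trans; cong; cong₂; subst; module ≡-Reasoning) renaming (sym to ≡-sym)

preimage : ∀ {n k} → (Fin n → Fin k) → Subset k → Subset n
preimage f A = tabulate (λ x → lookup A (f x))

module _ {n k} (f : Fin n → Fin k) (A : Subset k) where

  ∈-preimage⁻ : ∀ {x} → x ∈ preimage f A → f x ∈ A
  ∈-preimage⁻ {x} x∈ =
    lookup⇒[]= (f x) A (trans (≡-sym (lookup∘tabulate _ x)) ([]=⇒lookup x∈))

  ∈-preimage⁺ : ∀ {x} → f x ∈ A → x ∈ preimage f A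
  ∈-preimage⁺ {x} fx∈ =
    lookup⇒[]= x (preimage f A) (trans (lookup∘tabulate _ x) ([]=⇒lookup fx∈))

preimage-∘ : ∀ {n k l} (f : Fin n → Fin k) (g : Fin k → Fin l) A →
             preimage (g ∘ f) A ≡ preimage f (preimage g A)
preimage-∘ f g A = tabulate-cong (λ x → ≡-sym (lookup∘tabulate _ (f x)))

fibre : ∀ {n k} → (Fin n → Fin k) → Fin k → Subset n
fibre f a = preimage f ⁅ a ⁆

module _ {n k} (f : Fin n → Fin k) {a : Fin k} where

  ∈-fibre⁻ : ∀ {x} → x ∈ fibre f a → f x ≡ a
  ∈-fibre⁻ = x∈⁅y⁆⇒x≡y a ∘ ∈-preimage⁻ f ⁅ a ⁆

  ⊆-fibre : ∀ {S} → (∀ {x} → x ∈ S → f x ≡ a) → S ⊆ fibre f a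
  ⊆-fibre on-a x∈S = ∈-preimage⁺ f ⁅ a ⁆ (subst (_∈ ⁅ a ⁆) (≡-sym (on-a x∈S)) (x∈⁅x⁆ a))

∣p++q∣≡∣p∣+∣q∣ : ∀ {a b} (p : Subset a) (q : Subset b) → ∣ p ++ q ∣ ≡ ∣ p ∣ + ∣ q ∣
∣p++q∣≡∣p∣+∣q∣ []            q = refl
∣p++q∣≡∣p∣+∣q∣ (inside  ∷ p) q = cong suc (∣p++q∣≡∣p∣+∣q∣ p q)
∣p++q∣≡∣p∣+∣q∣ (outside ∷ p) q = ∣p++q∣≡∣p∣+∣q∣ p q

tabulate-++ : ∀ {A : Set} b {c} (f : Fin (b + c) → A) →
              tabulate f ≡ tabulate (f ∘ (_↑ˡ c)) ++ tabulate (f ∘ (b ↑ʳ_))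
tabulate-++ zero    f = refl
tabulate-++ (suc b) f = cong (f zero ∷_) (tabulate-++ b (f ∘ suc))

remQuot-↑ʳ : ∀ {a} b (y : Fin (a * b)) →
             remQuot {suc a} b (b ↑ʳ y) ≡ map₁ suc (remQuot {a} b y)
remQuot-↑ʳ {a} b y rewrite splitAt-↑ʳ b (a * b) y = refl

-- Fin (suc a * b) is Fin (b + a * b): the block with quotient 0, then the rest.
tabulate-remQuot : ∀ {A : Set} a b (g : Fin (suc a) × Fin b → A) →
                   tabulate (g ∘ remQuot {suc a} b)
                   ≡ tabulate (λ j → g (zero , j)) ++ tabulate (g ∘ map₁ suc ∘ remQuot {a} b)
tabulate-remQuot a b g = trans (tabulate-++ b (g ∘ remQuot b))
  (cong₂ _++_ (tabulate-cong (cong g ∘ remQuot-combine zero))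
              (tabulate-cong (cong g ∘ remQuot-↑ʳ b)))

tabulate-const : ∀ {A : Set} b (x : A) → tabulate {b} (λ _ → x) ≡ replicate b x
tabulate-const b x = trans (tabulate-∘ (λ _ → x) id) (map-const (allFin b) x)

∣preimage-fstᵖ∣ : ∀ a b (A : Subset a) → ∣ preimage (fstᵖ {a} {b}) A ∣ ≡ ∣ A ∣ * b
∣preimage-fstᵖ∣ zero    b []      = refl
∣preimage-fstᵖ∣ (suc a) b (x ∷ A) = begin
  ∣ preimage (fstᵖ {suc a} {b}) (x ∷ A) ∣  ≡⟨ cong ∣_∣ (tabulate-remQuot a b (lookup (x ∷ A) ∘ proj₁)) ⟩
  ∣ tabulate {b} (λ _ → x) ++ P ∣          ≡⟨ cong (λ p → ∣ p ++ P ∣) (tabulate-const b x) ⟩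
  ∣ replicate b x ++ P ∣                   ≡⟨ ∣p++q∣≡∣p∣+∣q∣ (replicate b x) P ⟩
  ∣ replicate b x ∣ + ∣ P ∣                ≡⟨ cong (∣ replicate b x ∣ +_) (∣preimage-fstᵖ∣ a b A) ⟩
  ∣ replicate b x ∣ + ∣ A ∣ * b            ≡⟨ ∣replicate∣+ x ⟩
  ∣ x ∷ A ∣ * b                            ∎
  where
  open ≡-Reasoning
  P : Subset (a * b)
  P = preimage (fstᵖ {a} {b}) A

  ∣replicate∣+ : ∀ x → ∣ replicate b x ∣ + ∣ A ∣ * b ≡ ∣ x ∷ A ∣ * b
  ∣replicate∣+ inside  = cong (_+ ∣ A ∣ * b) (∣⊤∣≡n b)
  ∣replicate∣+ outside = cong (_+ ∣ A ∣ * b) (∣⊥∣≡0 b)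

∣preimage-sndᵖ∣ : ∀ a b (B : Subset b) → ∣ preimage (sndᵖ {a} {b}) B ∣ ≡ a * ∣ B ∣
∣preimage-sndᵖ∣ zero    b B = refl
∣preimage-sndᵖ∣ (suc a) b B = begin
  ∣ preimage (sndᵖ {suc a} {b}) B ∣  ≡⟨ cong ∣_∣ (tabulate-remQuot a b (lookup B ∘ proj₂)) ⟩
  ∣ tabulate (lookup B) ++ P ∣       ≡⟨ cong (λ p → ∣ p ++ P ∣) (tabulate∘lookup B) ⟩
  ∣ B ++ P ∣                         ≡⟨ ∣p++q∣≡∣p∣+∣q∣ B P ⟩
  ∣ B ∣ + ∣ P ∣                      ≡⟨ cong (∣ B ∣ +_) (∣preimage-sndᵖ∣ a b B) ⟩
  ∣ B ∣ + a * ∣ B ∣                  ∎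
  where
  open ≡-Reasoning
  P : Subset (a * b)
  P = preimage (sndᵖ {a} {b}) B

-- If S is not constant under p, two members differ under p, so they agree under q,
-- and any third member, agreeing with both, must agree with them under q.
agreeing⇒⊆fibre : ∀ {n k l} (p : Fin n → Fin k) (q : Fin n → Fin l) → Fin k → (S : Subset n) →
                  (∀ {x y} → x ∈ S → y ∈ S → p x ≡ p y ⊎ q x ≡ q y) →
                  (∃ λ a → S ⊆ fibre p a) ⊎ (∃ λ b → S ⊆ fibre q b)
agreeing⇒⊆fibre p q a₀ S agree with any? (_∈? S)
... | no S-empty = inj₁ (a₀ , λ x∈S → contradiction (_ , x∈S) S-empty)
... | yes (x , x∈S) with any? (λ y → y ∈? S ×-dec ¬? (p y ≟ p x))
...   | no p-constant = inj₁ (p x , ⊆-fibre p λ {z} z∈S →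
          decidable-stable (p z ≟ p x) (λ pz≢px → p-constant (z , z∈S , pz≢px)))
...   | yes (y , y∈S , py≢px) = inj₂ (q x , ⊆-fibre q q-constant)
  where
  qy≡qx : q y ≡ q x
  qy≡qx = [ (λ py≡px → contradiction py≡px py≢px) , id ]′ (agree y∈S x∈S)

  q-constant : ∀ {z} → z ∈ S → q z ≡ q x
  q-constant {z} z∈S with agree z∈S x∈S
  ... | inj₂ qz≡qx = qz≡qx
  ... | inj₁ pz≡px with agree z∈S y∈S
  ...   | inj₁ pz≡py = contradiction (trans (≡-sym pz≡py) pz≡px) py≢px
  ...   | inj₂ qz≡qy = trans qz≡qy qy≡qx

maximal-⊆⇒≡ : ∀ G {S T} → MaximalIndependent G S → Independent G T → S ⊆ T → S ≡ T
maximal-⊆⇒≡ G (_ , maximal) T-independent S⊆T = ⊆-antisym S⊆T (maximal _ T-independent S⊆T)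

module MultipartiteProduct (m r m′ r′ : ℕ) where

  G : Graph
  G = completeMultipartite m r ×ᵍ completeMultipartite m′ r′

  part₁ : Fin (n G) → Fin m
  part₁ = fstᵖ {m} {r} ∘ fstᵖ {m * r} {m′ * r′}

  part₂ : Fin (n G) → Fin m′
  part₂ = fstᵖ {m′} {r′} ∘ sndᵖ {m * r} {m′ * r′}

  row : Fin m → Subset (n G)
  row = fibre part₁

  column : Fin m′ → Subset (n G)
  column = fibre part₂

  ∣row∣ : ∀ a → ∣ row a ∣ ≡ r * (m′ * r′)
  ∣row∣ a = begin
    ∣ row a ∣                                     ≡⟨ cong ∣_∣ (preimage-∘ (fstᵖ {m * r} {m′ * r′}) (fstᵖ {m} {r}) ⁅ a ⁆) ⟩
    ∣ preimage (fstᵖ {m * r} {m′ * r′}) part-a ∣  ≡⟨ ∣preimage-fstᵖ∣ (m * r) (m′ * r′) part-a ⟩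
    ∣ part-a ∣ * (m′ * r′)                        ≡⟨ cong (_* (m′ * r′)) (∣preimage-fstᵖ∣ m r ⁅ a ⁆) ⟩
    ∣ ⁅ a ⁆ ∣ * r * (m′ * r′)                     ≡⟨ cong (λ c → c * r * (m′ * r′)) (∣⁅x⁆∣≡1 a) ⟩
    1 * r * (m′ * r′)                             ≡⟨ cong (_* (m′ * r′)) (*-identityˡ r) ⟩
    r * (m′ * r′)                                 ∎
    where
    open ≡-Reasoning
    part-a : Subset (m * r)
    part-a = fibre (fstᵖ {m} {r}) a

  ∣column∣ : ∀ b → ∣ column b ∣ ≡ m * r * r′
  ∣column∣ b = begin
    ∣ column b ∣                                  ≡⟨ cong ∣_∣ (preimage-∘ (sndᵖ {m * r} {m′ * r′}) (fstᵖ {m′} {r′}) ⁅ b ⁆) ⟩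
    ∣ preimage (sndᵖ {m * r} {m′ * r′}) part-b ∣  ≡⟨ ∣preimage-sndᵖ∣ (m * r) (m′ * r′) part-b ⟩
    m * r * ∣ part-b ∣                            ≡⟨ cong (m * r *_) (∣preimage-fstᵖ∣ m′ r′ ⁅ b ⁆) ⟩
    m * r * (∣ ⁅ b ⁆ ∣ * r′)                      ≡⟨ cong (λ c → m * r * (c * r′)) (∣⁅x⁆∣≡1 b) ⟩
    m * r * (1 * r′)                              ≡⟨ cong (m * r *_) (*-identityˡ r′) ⟩
    m * r * r′                                    ∎
    where
    open ≡-Reasoning
    part-b : Subset (m′ * r′)
    part-b = fibre (fstᵖ {m′} {r′}) b

  row-independent : ∀ a → Independent G (row a)
  row-independent a x y x∈ y∈ (part₁≢ , _) =
    part₁≢ (trans (∈-fibre⁻ part₁ {a} x∈) (≡-sym (∈-fibre⁻ part₁ {a} y∈)))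

  column-independent : ∀ b → Independent G (column b)
  column-independent b x y x∈ y∈ (_ , part₂≢) =
    part₂≢ (trans (∈-fibre⁻ part₂ {b} x∈) (≡-sym (∈-fibre⁻ part₂ {b} y∈)))

  independent⇒agreeing : ∀ {S} → Independent G S → ∀ {x y} → x ∈ S → y ∈ S →
                         part₁ x ≡ part₁ y ⊎ part₂ x ≡ part₂ y
  independent⇒agreeing S-independent {x} {y} x∈S y∈S with part₁ x ≟ part₁ y | part₂ x ≟ part₂ y
  ... | yes part₁≡ | _           = inj₁ part₁≡
  ... | no _       | yes part₂≡  = inj₂ part₂≡
  ... | no part₁≢  | no part₂≢   = contradiction (part₁≢ , part₂≢) (S-independent x y x∈S y∈S)

  maximal⇒row⊎column : Fin m → ∀ {S} → MaximalIndependent G S →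
                       (∃ λ a → S ≡ row a) ⊎ (∃ λ b → S ≡ column b)
  maximal⇒row⊎column a₀ {S} S-maximal@(S-independent , _)
    with agreeing⇒⊆fibre part₁ part₂ a₀ S (independent⇒agreeing S-independent)
  ... | inj₁ (a , S⊆row)    = inj₁ (a , maximal-⊆⇒≡ G S-maximal (row-independent a) S⊆row)
  ... | inj₂ (b , S⊆column) = inj₂ (b , maximal-⊆⇒≡ G S-maximal (column-independent b) S⊆column)

  ∣maximal∣ : Fin m → ∀ {S} → MaximalIndependent G S → ∣ S ∣ ≡ r * (m′ * r′) ⊎ ∣ S ∣ ≡ m * r * r′
  ∣maximal∣ a₀ S-maximal with maximal⇒row⊎column a₀ S-maximal
  ... | inj₁ (a , refl) = inj₁ (∣row∣ a)
  ... | inj₂ (b , refl) = inj₂ (∣column∣ b)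

proposition5p5 : (r m : ℕ) → .{{_ : NonZero r}} → .{{_ : NonZero m}} →
    WellCovered (completeMultipartite m r ×ᵍ completeMultipartite m r)
proposition5p5 r m S T S-maximal T-maximal = trans (∣maximal∣≡ S-maximal) (≡-sym (∣maximal∣≡ T-maximal))
  where
  open MultipartiteProduct m r m r

  ∣maximal∣≡ : ∀ {S} → MaximalIndependent G S → ∣ S ∣ ≡ r * (m * r)
  ∣maximal∣≡ S-maximal = [ id , (λ ∣S∣≡∣column∣ → trans ∣S∣≡∣column∣ (*-comm (m * r) r)) ]′
                         (∣maximal∣ (fromℕ< (>-nonZero⁻¹ m)) S-maximal)
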